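{- A cubic graph has a $(2,2)$-ChNZF if and only if it is $3$-edge-colourable.
   Context: An $\mathbb{R}^2$-flow on a graph $G=(V,E)$ consists of an orientation of the edges and a map $\varphi\colon E\to\mathbb{R}^2$ such that at every vertex the sum of values on incoming edges equals the sum on outgoing edges. A $(2,2)$-ChNZF is an $\mathbb{R}^2$-flow with $\|\varphi(e)\|_\infty=1$ for every edge $e$ (i.e. $1\le\|\varphi(e)\|_\infty\le 1$), where $\|(x,y)\|_\infty=\max(|x|,|y|)$. -}

module Defs where

open import Level using (0ℓ)
open import Data.Nat using (ℕ)
open import Data.Nat as ℕ using ()
open import Data.Bool using (Bool; true; false; if_then_else_)
open import Data.Fin using (Fin; zero; suc; _≟_)
open import Data.Product using (Σ; ∃; _×_; _,_)
open import Data.Sum using (_⊎_)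
open import Relation.Nullary using (¬_; does)
open import Relation.Binary.PropositionalEquality using (_≡_; _≢_)
open import Relation.Binary.Structures using (IsTotalOrder)
open import Algebra.Bundles using (CommutativeRing)

-- The real numbers, given abstractly as a complete ordered field.
-- (agda-stdlib has no ℝ; every complete ordered field is isomorphic to ℝ,
-- so quantifying over all such structures is the same as speaking of ℝ.)

record RealField : Set₁ where
  field
    commRing : CommutativeRing 0ℓ 0ℓ
  open CommutativeRing commRing public
  field
    _≤_        : Carrier → Carrier → Set
    nontrivial : ¬ (0# ≈ 1#)
    inverse    : ∀ x → ¬ (x ≈ 0#) → ∃ λ y → (x * y) ≈ 1#
    ≤-isTotalOrder : IsTotalOrder _≈_ _≤_
    +-mono-≤   : ∀ {x y} z → x ≤ y → (x + z) ≤ (y + z)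
    *-nonneg   : ∀ {x y} → 0# ≤ x → 0# ≤ y → 0# ≤ (x * y)
    complete   : (P : Carrier → Set) → (∃ λ x → P x) →
                 (∃ λ b → ∀ x → P x → x ≤ b) →
                 ∃ λ s → (∀ x → P x → x ≤ s) ×
                         (∀ b → (∀ x → P x → x ≤ b) → s ≤ b)

record Graph : Set where
  field
    n m   : ℕ
    end₁  : Fin m → Fin n
    end₂  : Fin m → Fin n
    loopless : ∀ e → end₁ e ≢ end₂ e

module _ (G : Graph) where
  open Graph G

  private
    ind : ∀ {k} → Fin k → Fin k → ℕ
    ind a b = if does (a ≟ b) then 1 else 0

    sumℕ : ∀ {k} → (Fin k → ℕ) → ℕ
    sumℕ {ℕ.zero}  f = 0
    sumℕ {ℕ.suc k} f = f zero ℕ.+ sumℕ (λ i → f (suc i))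

  degree : Fin n → ℕ
  degree v = sumℕ (λ e → ind (end₁ e) v ℕ.+ ind (end₂ e) v)

  Cubic : Set
  Cubic = ∀ v → degree v ≡ 3

  Adjacent : Fin m → Fin m → Set
  Adjacent e f = e ≢ f ×
    ((end₁ e ≡ end₁ f ⊎ end₁ e ≡ end₂ f) ⊎ (end₂ e ≡ end₁ f ⊎ end₂ e ≡ end₂ f))

  ThreeEdgeColourable : Set
  ThreeEdgeColourable =
    Σ (Fin m → Fin 3) λ c → ∀ e f → Adjacent e f → c e ≢ c f

module _ (R : RealField) where
  open RealField R using (Carrier; _≈_; _+_; -_; 0#; 1#; _≤_)

  sumR : ∀ {k} → (Fin k → Carrier) → Carrier
  sumR {ℕ.zero}  f = 0#
  sumR {ℕ.suc k} f = f zero + sumR (λ i → f (suc i))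

  SupNormOne : Carrier × Carrier → Set
  SupNormOne (x , y) =
    ((- 1#) ≤ x × x ≤ 1# × (- 1#) ≤ y × y ≤ 1#) ×
    ((x ≈ 1# ⊎ x ≈ (- 1#)) ⊎ (y ≈ 1# ⊎ y ≈ (- 1#)))

  module _ (G : Graph) where
    open Graph G

    -- An orientation: for each edge, true = end₁ → end₂, false = end₂ → end₁
    tail head : (Fin m → Bool) → Fin m → Fin n
    tail o e = if o e then end₁ e else end₂ e
    head o e = if o e then end₂ e else end₁ e

    private
      pick : ∀ {k} → Fin k → Fin k → Carrier → Carrier
      pick a b x = if does (a ≟ b) then x else 0#

    IsR2Flow : (Fin m → Bool) → (Fin m → Carrier × Carrier) → Set
    IsR2Flow o φ = ∀ v →
      (sumR (λ e → pick (head o e) v (Data.Product.proj₁ (φ e)))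
        ≈ sumR (λ e → pick (tail o e) v (Data.Product.proj₁ (φ e)))) ×
      (sumR (λ e → pick (head o e) v (Data.Product.proj₂ (φ e)))
        ≈ sumR (λ e → pick (tail o e) v (Data.Product.proj₂ (φ e))))

    Has22ChNZF : Set
    Has22ChNZF = Σ (Fin m → Bool) λ o → Σ (Fin m → Carrier × Carrier) λ φ →
      IsR2Flow o φ × (∀ e → SupNormOne (φ e))

-- For colours {0,1}, and likewise {0,2}, the edges of the two colours form disjoint
-- even cycles, so the vertices split into two sides that alternate along them.  Orient every edge from
-- end₁ to end₂; in coordinate i an edge of colour 0 or i gets ±1 according to the side of its tail, any
-- other edge gets 0.  Each coordinate is a flow and every value has sup-norm one.  Colour a value (x , y) by which of x = ±1 ∨ xy > 0 and y = ±1 ∨ xy > 0 hold.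
-- The outflows at a vertex are three points on the boundary of the unit square summing to zero, and a
-- case analysis shows that exactly two of them satisfy each condition; so the colours at a vertex are
-- distinct.  A colour exists only under double negation, which suffices because 3-edge-colourability is
-- decidable.

module Submission where

open import Defs

open import Algebra.Bundles using (CommutativeMonoid)
open import Data.Bool using (Bool; true; false; not; if_then_else_)
open import Data.Empty using (⊥; ⊥-elim)
open import Data.Fin using (Fin; zero; suc; toℕ; fromℕ<)
import Data.Fin as Fin
open import Data.Fin.Base using (punchOut; finToFun; funToFin)
open import Data.Fin.Patterns using (0F; 1F; 2F)
open import Data.Fin.Properties
  using (suc-injective; ¬∀⟶∃¬; any?; all?; injective⇒≤; punchOut-injective; finToFun-funToFin;
         pigeonhole; toℕ-fromℕ<; <-cmp; <-asym; sequence)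
import Data.Fin.Properties as Finₚ
open import Data.Maybe using (nothing)
open import Data.Nat using (ℕ; zero; suc; z≤n; s≤s)
import Data.Nat as ℕ
open import Data.Nat.DivMod using (m≡m%n+[m/n]*n; m%n<n)
import Data.Nat.Properties as ℕₚ
open import Data.Product using (∃; _×_; _,_; proj₁; proj₂)
open import Data.Sum using (_⊎_; inj₁; inj₂; [_,_]′)
import Data.Sum as Sum
open import Data.Vec.Functional using (_∷_; updateAt)
open import Data.Vec.Functional.Properties using (updateAt-updates; updateAt-minimal)
open import Effect.Monad using (RawMonad)
open import Function using (_∘_; id; const)
open import Function.Bundles using (_⇔_; mk⇔; Equivalence)
open import Function.Definitions using (Injective)
open import Level using (0ℓ)
open import Relation.Binary.Definitions using (tri<; tri≈; tri>)
open import Relation.Binary.PropositionalEquality using (_≡_; _≢_; refl; cong-app)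
import Relation.Binary.PropositionalEquality as ≡
open import Relation.Binary.Structures using (IsTotalOrder)
open import Relation.Nullary using (¬_; Dec; yes; no; does; contradiction)
open import Relation.Nullary.Decidable
  using (dec-true; dec-false; _⊎-dec_; _×-dec_; _→-dec_; ¬?; map′; decidable-stable; ¬¬-excluded-middle)
open import Relation.Nullary.Negation using (¬¬-Monad)
open import Tactic.RingSolver.Core.AlmostCommutativeRing using (fromCommutativeRing)

record Enumeration {k : ℕ} (P : Fin k → Set) (s : ℕ) : Set where
  field
    elem           : Fin s → Fin k
    elem-injective : Injective _≡_ _≡_ elem
    elem-sound     : ∀ j → P (elem j)
    elem-complete  : ∀ {i} → P i → ∃ λ j → elem j ≡ i

module FiniteSum {c ℓ} (M : CommutativeMonoid c ℓ) where
  open CommutativeMonoid M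
    using (Carrier; _≈_; ∙-congˡ; identityˡ; setoid; commutativeSemigroup)
    renaming (_∙_ to _+′_; ε to 0#; sym to ≈-sym; trans to ≈-trans; reflexive to ≈-reflexive)
  open import Algebra.Properties.CommutativeMonoid.Sum M public
    using (sum; sum-cong-≋; sum-cong-≗; sum-replicate-zero)
  open import Algebra.Properties.CommutativeSemigroup commutativeSemigroup
    using (x∙yz≈y∙xz)
  open import Relation.Binary.Reasoning.Setoid setoid

  erase : ∀ {k} → (Fin k → Carrier) → Fin k → Fin k → Carrier
  erase f i = updateAt f i (const 0#)

  erase-at : ∀ {k} (f : Fin k → Carrier) i → erase f i i ≡ 0#
  erase-at f i = updateAt-updates i f

  erase-elsewhere : ∀ {k} (f : Fin k → Carrier) {i j} → j ≢ i → erase f i j ≡ f j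
  erase-elsewhere f = updateAt-minimal _ _ f

  sum-erase : ∀ {k} (f : Fin k → Carrier) i → sum f ≈ f i +′ sum (erase f i)
  sum-erase f zero    = ∙-congˡ (≈-sym (identityˡ _))
  sum-erase f (suc i) = begin
    f zero +′ sum (f ∘ suc)                         ≈⟨ ∙-congˡ (sum-erase (f ∘ suc) i) ⟩
    f zero +′ (f (suc i) +′ sum (erase (f ∘ suc) i)) ≈⟨ x∙yz≈y∙xz _ _ _ ⟩
    f (suc i) +′ (f zero +′ sum (erase (f ∘ suc) i)) ∎

  sum-support : ∀ {s k} (t : Fin s → Fin k) → Injective _≡_ _≡_ t → (f : Fin k → Carrier) →
                (∀ i → (∀ j → t j ≢ i) → f i ≈ 0#) → sum f ≈ sum (f ∘ t)
  sum-support {zero} {k} t _ f outside =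
    ≈-trans (sum-cong-≋ (λ i → outside i λ ())) (sum-replicate-zero k)
  sum-support {suc s} t inj f outside = begin
    sum f                          ≈⟨ sum-erase f (t zero) ⟩
    f (t zero) +′ sum f′             ≈⟨ ∙-congˡ (sum-support (t ∘ suc) (suc-injective ∘ inj) f′ outside′) ⟩
    f (t zero) +′ sum (f′ ∘ t ∘ suc) ≡⟨ ≡.cong (f (t zero) +′_) (sum-cong-≗ λ j →
                                         erase-elsewhere f (λ eq → 0≢suc (inj {zero} {suc j} (≡.sym eq)))) ⟩
    sum (f ∘ t)                      ∎
    where
    f′ = erase f (t zero)
    0≢suc : ∀ {j : Fin s} → zero ≢ suc j
    0≢suc ()
    outside′ : ∀ i → (∀ j → t (suc j) ≢ i) → f′ i ≈ 0#
    outside′ i ∉ with i Fin.≟ t zero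
    ... | yes refl = ≈-reflexive (erase-at f (t zero))
    ... | no i≢t₀  = ≈-trans (≈-reflexive (erase-elsewhere f i≢t₀)) (outside i λ
      { zero eq → i≢t₀ (≡.sym eq) ; (suc j) eq → ∉ j eq })

module _ where
  open FiniteSum ℕₚ.+-0-commutativeMonoid
  open import Data.Nat using (_+_; _≤_)

  sum≡0⇒zero : ∀ {k} (f : Fin k → ℕ) → sum f ≡ 0 → ∀ i → f i ≡ 0
  sum≡0⇒zero f Σf≡0 i = ℕₚ.m+n≡0⇒m≡0 (f i) (≡.trans (≡.sym (sum-erase f i)) Σf≡0)

  enumerate-ones : ∀ {k} (f : Fin k → ℕ) → (∀ i → f i ≤ 1) →
                   ∀ s → sum f ≡ s → Enumeration (λ i → f i ≡ 1) s
  enumerate-ones f f≤1 zero Σf≡0 = record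
    { elem           = λ ()
    ; elem-injective = λ { {()} }
    ; elem-sound     = λ ()
    ; elem-complete  = λ {i} fi≡1 → contradiction (≡.trans (≡.sym fi≡1) (sum≡0⇒zero f Σf≡0 i)) λ ()
    }
  enumerate-ones f f≤1 (suc s) Σf≡1+s = record
    { elem           = a ∷ elem
    ; elem-injective = injective
    ; elem-sound     = λ { zero → fa≡1
                         ; (suc j) → ≡.trans (≡.sym (erase-elsewhere f (a∉ j ∘ ≡.sym))) (elem-sound j) }
    ; elem-complete  = complete
    }
    where
    nonzero : ∃ λ a → f a ≢ 0
    nonzero = ¬∀⟶∃¬ _ (λ i → f i ≡ 0) (λ i → f i ℕ.≟ 0) λ all-zero →
      ℕₚ.0≢1+n (≡.trans (≡.sym (sum-support {zero} (λ ()) (λ { {()} }) f (λ i _ → all-zero i))) Σf≡1+s)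
    a = proj₁ nonzero
    fa≡1 : f a ≡ 1
    fa≡1 = ℕₚ.≤-antisym (f≤1 a) (ℕₚ.n≢0⇒n>0 (proj₂ nonzero))
    f′ = erase f a
    f′≤1 : ∀ i → f′ i ≤ 1
    f′≤1 i with i Fin.≟ a
    ... | yes refl = ≡.subst (_≤ 1) (≡.sym (erase-at f a)) z≤n
    ... | no i≢a   = ≡.subst (_≤ 1) (≡.sym (erase-elsewhere f i≢a)) (f≤1 i)
    Σf′≡s : sum f′ ≡ s
    Σf′≡s = ℕₚ.suc-injective (≡.trans (≡.cong (_+ sum f′) (≡.sym fa≡1))
                                      (≡.trans (≡.sym (sum-erase f a)) Σf≡1+s))
    open Enumeration (enumerate-ones f′ f′≤1 s Σf′≡s)
    a∉ : ∀ j → a ≢ elem j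
    a∉ j a≡ = ℕₚ.0≢1+n (≡.trans (≡.sym (erase-at f a))
                                (≡.subst (λ i → f′ i ≡ 1) (≡.sym a≡) (elem-sound j)))
    injective : Injective _≡_ _≡_ (a ∷ elem)
    injective {zero}  {zero}  _  = refl
    injective {zero}  {suc j} eq = contradiction eq (a∉ j)
    injective {suc i} {zero}  eq = contradiction (≡.sym eq) (a∉ i)
    injective {suc i} {suc j} eq = ≡.cong suc (elem-injective eq)
    complete : ∀ {i} → f i ≡ 1 → ∃ λ j → (a ∷ elem) j ≡ i
    complete {i} fi≡1 with i Fin.≟ a
    ... | yes refl = zero , refl
    ... | no i≢a   = let j , eq = elem-complete (≡.trans (erase-elsewhere f i≢a) fi≡1) in suc j , eq

injective⇒surjective : ∀ {k} {f : Fin k → Fin k} → Injective _≡_ _≡_ f → ∀ i → ∃ λ j → f j ≡ i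
injective⇒surjective {zero}  _   ()
injective⇒surjective {suc k} {f} inj i with any? (λ j → f j Fin.≟ i)
... | yes hit = hit
... | no miss = contradiction (injective⇒≤ {f = λ j → punchOut (avoids j)} punchOut∘f-injective) ℕₚ.1+n≰n
  where
  avoids : ∀ j → i ≢ f j
  avoids j eq = miss (j , ≡.sym eq)
  punchOut∘f-injective : Injective _≡_ _≡_ (λ j → punchOut (avoids j))
  punchOut∘f-injective eq = inj (punchOut-injective (avoids _) (avoids _) eq)

even⊎odd : ∀ k → ∃ λ h → k ≡ h ℕ.+ h ⊎ k ≡ suc (h ℕ.+ h)
even⊎odd zero    = 0 , inj₁ refl
even⊎odd (suc k) with even⊎odd k
... | h , inj₁ k≡2h   = h , inj₂ (≡.cong suc k≡2h)
... | h , inj₂ k≡2h+1 = suc h , inj₁ (≡.cong suc (≡.trans k≡2h+1 (≡.sym (ℕₚ.+-suc h h))))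

<-flip : ∀ {k} {a b : Fin k} → a ≢ b → does (b Fin.<? a) ≡ not (does (a Fin.<? b))
<-flip {a = a} {b} a≢b with <-cmp a b
... | tri< a<b _ _ = ≡.trans (dec-false (b Fin.<? a) (<-asym a<b)) (≡.cong not (≡.sym (dec-true (a Fin.<? b) a<b)))
... | tri≈ _ a≡b _ = contradiction a≡b a≢b
... | tri> _ _ b<a = ≡.trans (dec-true (b Fin.<? a) b<a) (≡.cong not (≡.sym (dec-false (a Fin.<? b) (<-asym b<a))))

record Least {k : ℕ} (P : Fin k → Set) : Set where
  field
    elem    : Fin k
    holds   : P elem
    minimal : ∀ {i} → P i → elem Fin.≤ i

least : ∀ {k} {P : Fin k → Set} → (∀ i → Dec (P i)) → ∃ P → Least P
least {suc k} {P} P? ∃P with P? zero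
... | yes p₀ = record { elem = zero ; holds = p₀ ; minimal = λ _ → z≤n }
... | no ¬p₀ = record { elem = suc elem ; holds = holds ; minimal = minimal′ }
  where
  witness : ∃ P → ∃ (P ∘ suc)
  witness (zero  , p₀) = contradiction p₀ ¬p₀
  witness (suc j , pj) = j , pj
  open Least (least (P? ∘ suc) (witness ∃P))
  minimal′ : ∀ {j} → P j → suc elem Fin.≤ j
  minimal′ {zero}  p₀ = contradiction p₀ ¬p₀
  minimal′ {suc j} pj = s≤s (minimal pj)

least-unique : ∀ {k} {P Q : Fin k → Set} (L : Least P) (M : Least Q) →
  (∀ {i} → P i → Q i) → (∀ {i} → Q i → P i) → Least.elem L ≡ Least.elem M
least-unique L M P⇒Q Q⇒P =
  Finₚ.≤-antisym (Least.minimal L (Q⇒P (Least.holds M))) (Least.minimal M (P⇒Q (Least.holds L)))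

-- The edges of two perfect matchings σ, τ form even alternating cycles, walked two steps at a time by
-- π = τ ∘ σ.  By parity σ never maps v into its own π-orbit, so comparing the least elements of the
-- π-orbits of v and σ v splits the points into two sides exchanged by both σ and τ.
module Alternation {n : ℕ} (σ τ : Fin n → Fin n)
  (σ-involutive : ∀ v → σ (σ v) ≡ v) (τ-involutive : ∀ v → τ (τ v) ≡ v)
  (σ-fixpoint-free : ∀ v → σ v ≢ v) (τ-fixpoint-free : ∀ v → τ v ≢ v) where

  open import Data.Nat using (_+_; _*_; _%_; _/_)
  open import Function.Endo.Propositional (Fin n) using (_^_; ^-homo)

  π : Fin n → Fin n
  π = τ ∘ σ

  π-injective : Injective _≡_ _≡_ π
  π-injective {u} {w} πu≡πw =
    ≡.trans (≡.sym (σ-involutive u)) (≡.trans (≡.cong σ σu≡σw) (σ-involutive w))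
    where
    σu≡σw : σ u ≡ σ w
    σu≡σw = ≡.trans (≡.sym (τ-involutive (σ u))) (≡.trans (≡.cong τ πu≡πw) (τ-involutive (σ w)))

  iterate-+ : ∀ a b v → (π ^ (a + b)) v ≡ (π ^ a) ((π ^ b) v)
  iterate-+ a b = cong-app (^-homo π a b)

  iterate-injective : ∀ k → Injective _≡_ _≡_ (π ^ k)
  iterate-injective zero    = id
  iterate-injective (suc k) = iterate-injective k ∘ π-injective

  iterate-periodic : ∀ {p v} → (π ^ p) v ≡ v → ∀ q → (π ^ (q * p)) v ≡ v
  iterate-periodic         πᵖv≡v zero    = refl
  iterate-periodic {p} {v} πᵖv≡v (suc q) =
    ≡.trans (iterate-+ p (q * p) v) (≡.trans (≡.cong (π ^ p) (iterate-periodic πᵖv≡v q)) πᵖv≡v)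

  period : ∀ v → ∃ λ p → (π ^ suc p) v ≡ v
  period v with pigeonhole (ℕₚ.n<1+n n) (λ (i : Fin (suc n)) → (π ^ toℕ i) v)
  ... | i , j , i<j , πⁱv≡πʲv with ℕₚ.m≤n⇒∃[o]m+o≡n i<j
  ...   | d , i+1+d≡j = d , ≡.sym (iterate-injective (toℕ i) (≡.trans πⁱv≡πʲv
          (≡.trans (≡.cong (λ e → (π ^ e) v) (≡.sym (≡.trans (ℕₚ.+-suc (toℕ i) d) i+1+d≡j)))
                   (iterate-+ (toℕ i) (suc d) v))))

  π-σ-π : ∀ v → π (σ (π v)) ≡ σ v
  π-σ-π v = ≡.trans (≡.cong τ (σ-involutive (τ (σ v)))) (τ-involutive (σ v))

  conjugate : ∀ k v → (π ^ k) (σ ((π ^ k) v)) ≡ σ v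
  conjugate zero    v = refl
  conjugate (suc k) v = begin
    (π ^ suc k) (σ (π ((π ^ k) v)))  ≡⟨ ≡.cong (λ e → (π ^ e) (σ (π ((π ^ k) v)))) (ℕₚ.+-comm 1 k) ⟩
    (π ^ (k + 1)) (σ (π ((π ^ k) v))) ≡⟨ iterate-+ k 1 _ ⟩
    (π ^ k) (π (σ (π ((π ^ k) v))))   ≡⟨ ≡.cong (π ^ k) (π-σ-π ((π ^ k) v)) ⟩
    (π ^ k) (σ ((π ^ k) v))           ≡⟨ conjugate k v ⟩
    σ v                               ∎
    where open ≡.≡-Reasoning

  Reach : Fin n → Fin n → Set
  Reach v w = ∃ λ k → (π ^ k) v ≡ w

  reach-trans : ∀ {u v w} → Reach u v → Reach v w → Reach u w
  reach-trans {u} (k , πᵏu≡v) (l , πˡv≡w) =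
    l + k , ≡.trans (iterate-+ l k u) (≡.trans (≡.cong (π ^ l) πᵏu≡v) πˡv≡w)

  reach-sym : ∀ {v w} → Reach v w → Reach w v
  reach-sym {v} (k , ≡.refl) with period v
  ... | p , πᵖ⁺¹v≡v = k * p , ≡.trans (≡.sym (iterate-+ (k * p) k v))
    (≡.trans (≡.cong (λ e → (π ^ e) v) (≡.trans (ℕₚ.+-comm (k * p) k) (≡.sym (ℕₚ.*-suc k p))))
             (iterate-periodic πᵖ⁺¹v≡v k))

  iterate-mod-period : ∀ v k → let P = suc (proj₁ (period v)) in (π ^ k) v ≡ (π ^ (k % P)) v
  iterate-mod-period v k = begin
    (π ^ k) v                           ≡⟨ ≡.cong (λ e → (π ^ e) v) (m≡m%n+[m/n]*n k P) ⟩
    (π ^ (k % P + k / P * P)) v         ≡⟨ iterate-+ (k % P) (k / P * P) v ⟩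
    (π ^ (k % P)) ((π ^ (k / P * P)) v) ≡⟨ ≡.cong (π ^ (k % P)) (iterate-periodic (proj₂ (period v)) (k / P)) ⟩
    (π ^ (k % P)) v                     ∎
    where
    open ≡.≡-Reasoning
    P = suc (proj₁ (period v))

  reach? : ∀ v w → Dec (Reach v w)
  reach? v w = map′ (λ (j , eq) → toℕ j , eq) bounded (any? λ (j : Fin P) → (π ^ toℕ j) v Fin.≟ w)
    where
    P = suc (proj₁ (period v))
    bounded : Reach v w → ∃ λ (j : Fin P) → (π ^ toℕ j) v ≡ w
    bounded (k , πᵏv≡w) = fromℕ< (m%n<n k P) ,
      ≡.trans (≡.cong (λ e → (π ^ e) v) (toℕ-fromℕ< (m%n<n k P)))
              (≡.trans (≡.sym (iterate-mod-period v k)) πᵏv≡w)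

  ¬reach-σ : ∀ v → ¬ Reach v (σ v)
  ¬reach-σ v (k , πᵏv≡σv) with even⊎odd k
  ... | h , inj₁ refl = σ-fixpoint-free ((π ^ h) v) (iterate-injective h
          (≡.trans (conjugate h v) (≡.trans (≡.sym πᵏv≡σv) (iterate-+ h h v))))
  ... | h , inj₂ refl = τ-fixpoint-free (σ u) (≡.trans (≡.sym (σ-involutive (τ (σ u)))) (≡.cong σ σπu≡u))
    where
    u = (π ^ h) v
    σπu≡u : σ (π u) ≡ u
    σπu≡u = iterate-injective (suc h)
      (≡.trans (conjugate (suc h) v) (≡.trans (≡.sym πᵏv≡σv) (iterate-+ (suc h) h v)))

  -- Opaque: only the properties below are used, and unfolding the orbit search makes type checking
  -- of clients prohibitively slow.
  opaque
    representative : Fin n → Fin n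
    representative v = Least.elem (least (reach? v) (v , 0 , refl))

    representative-cong : ∀ {v w} → Reach v w → representative v ≡ representative w
    representative-cong v↝w = least-unique (least (reach? _) _) (least (reach? _) _)
      (reach-trans (reach-sym v↝w)) (reach-trans v↝w)

    representative-reach : ∀ v → Reach v (representative v)
    representative-reach v = Least.holds (least (reach? v) (v , 0 , refl))

    representative-σ : ∀ v → representative v ≢ representative (σ v)
    representative-σ v eq = ¬reach-σ v (reach-trans (representative-reach v)
      (≡.subst (λ r → Reach r (σ v)) (≡.sym eq) (reach-sym (representative-reach (σ v)))))

    side : Fin n → Bool
    side v = does (representative v Fin.<? representative (σ v))

    side-σ : ∀ v → side (σ v) ≡ not (side v)
    side-σ v = ≡.trans (≡.cong (λ w → does (representative (σ v) Fin.<? representative w)) (σ-involutive v))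
      (<-flip (representative-σ v))

    side-τ : ∀ v → side (τ v) ≡ not (side v)
    side-τ v = ≡.trans (≡.cong₂ (λ a b → does (a Fin.<? b)) rep-τ rep-στ) (side-σ v)
      where
      rep-τ : representative (τ v) ≡ representative (σ v)
      rep-τ = ≡.sym (representative-cong (1 , ≡.cong τ (σ-involutive v)))
      rep-στ : representative (σ (τ v)) ≡ representative (σ (σ v))
      rep-στ = ≡.trans (representative-cong (1 , ≡.trans (≡.cong τ (σ-involutive (τ v))) (τ-involutive v)))
        (≡.cong representative (≡.sym (σ-involutive v)))

indicator : ∀ {k} → Fin k → Fin k → ℕ
indicator a b = if does (a Fin.≟ b) then 1 else 0

indicator-≡ : ∀ {k} {a b : Fin k} → a ≡ b → indicator a b ≡ 1
indicator-≡ {a = a} {b} a≡b = ≡.cong (if_then 1 else 0) (dec-true (a Fin.≟ b) a≡b)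

indicator-≢ : ∀ {k} {a b : Fin k} → a ≢ b → indicator a b ≡ 0
indicator-≢ {a = a} {b} a≢b = ≡.cong (if_then 1 else 0) (dec-false (a Fin.≟ b) a≢b)

module _ where
  open FiniteSum ℕₚ.+-0-commutativeMonoid using (sum)
  open import Data.Nat using (_+_)

  -- Stated for an arbitrary record so that the induction can drop the first edge.
  degree≡sum : ∀ {n m} (end₁ end₂ : Fin m → Fin n) (loopless : ∀ e → end₁ e ≢ end₂ e) v →
    degree (record { n = n ; m = m ; end₁ = end₁ ; end₂ = end₂ ; loopless = loopless }) v
      ≡ sum (λ e → indicator (end₁ e) v + indicator (end₂ e) v)
  degree≡sum {m = zero}  _    _    _        _ = refl
  degree≡sum {m = suc m} end₁ end₂ loopless v = ≡.cong (indicator (end₁ zero) v + indicator (end₂ zero) v +_)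
    (degree≡sum (end₁ ∘ suc) (end₂ ∘ suc) (loopless ∘ suc) v)

module _ (G : Graph) where
  open Graph G
  open import Data.Nat using (_+_; _≤_)

  Incident : Fin n → Fin m → Set
  Incident v e = end₁ e ≡ v ⊎ end₂ e ≡ v

  incident? : ∀ v e → Dec (Incident v e)
  incident? v e = (end₁ e Fin.≟ v) ⊎-dec (end₂ e Fin.≟ v)

  incident⇒adjacent : ∀ {v e f} → Incident v e → Incident v f → e ≢ f → Adjacent G e f
  incident⇒adjacent (inj₁ p) (inj₁ q) e≢f = e≢f , inj₁ (inj₁ (≡.trans p (≡.sym q)))
  incident⇒adjacent (inj₁ p) (inj₂ q) e≢f = e≢f , inj₁ (inj₂ (≡.trans p (≡.sym q)))
  incident⇒adjacent (inj₂ p) (inj₁ q) e≢f = e≢f , inj₂ (inj₁ (≡.trans p (≡.sym q)))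
  incident⇒adjacent (inj₂ p) (inj₂ q) e≢f = e≢f , inj₂ (inj₂ (≡.trans p (≡.sym q)))

  adjacent⇒common-vertex : ∀ {e f} → Adjacent G e f → ∃ λ v → Incident v e × Incident v f
  adjacent⇒common-vertex {e} (_ , inj₁ (inj₁ p)) = end₁ e , inj₁ refl , inj₁ (≡.sym p)
  adjacent⇒common-vertex {e} (_ , inj₁ (inj₂ p)) = end₁ e , inj₁ refl , inj₂ (≡.sym p)
  adjacent⇒common-vertex {e} (_ , inj₂ (inj₁ p)) = end₂ e , inj₂ refl , inj₁ (≡.sym p)
  adjacent⇒common-vertex {e} (_ , inj₂ (inj₂ p)) = end₂ e , inj₂ refl , inj₂ (≡.sym p)

  incidence : Fin n → Fin m → ℕ
  incidence v e = indicator (end₁ e) v + indicator (end₂ e) v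

  incidence-incident : ∀ {v e} → Incident v e → incidence v e ≡ 1
  incidence-incident {e = e} (inj₁ p) =
    ≡.cong₂ _+_ (indicator-≡ p) (indicator-≢ λ q → loopless e (≡.trans p (≡.sym q)))
  incidence-incident {e = e} (inj₂ q) =
    ≡.cong₂ _+_ (indicator-≢ λ p → loopless e (≡.trans p (≡.sym q))) (indicator-≡ q)

  incidence-nonincident : ∀ {v e} → ¬ Incident v e → incidence v e ≡ 0
  incidence-nonincident ¬inc = ≡.cong₂ _+_ (indicator-≢ (¬inc ∘ inj₁)) (indicator-≢ (¬inc ∘ inj₂))

  incidence≤1 : ∀ v e → incidence v e ≤ 1
  incidence≤1 v e with incident? v e
  ... | yes inc  = ℕₚ.≤-reflexive (incidence-incident inc)
  ... | no ¬inc = ≡.subst (_≤ 1) (≡.sym (incidence-nonincident ¬inc)) z≤n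

  incidence≡1⇒incident : ∀ {v e} → incidence v e ≡ 1 → Incident v e
  incidence≡1⇒incident {v} {e} one with incident? v e
  ... | yes inc  = inc
  ... | no ¬inc = contradiction (≡.trans (≡.sym (incidence-nonincident ¬inc)) one) λ ()

  -- Opaque for the same reason as representative.
  opaque
    edgesAt : Cubic G → ∀ v → Enumeration (Incident v) 3
    edgesAt cubic v = record
      { elem           = elem
      ; elem-injective = elem-injective
      ; elem-sound     = incidence≡1⇒incident ∘ elem-sound
      ; elem-complete  = elem-complete ∘ incidence-incident
      }
      where open Enumeration (enumerate-ones (incidence v) (incidence≤1 v) 3
                                (≡.trans (≡.sym (degree≡sum end₁ end₂ loopless v)) (cubic v)))

  adjacent? : ∀ e f → Dec (Adjacent G e f)
  adjacent? e f = ¬? (e Fin.≟ f) ×-dec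
    ((end₁ e Fin.≟ end₁ f ⊎-dec end₁ e Fin.≟ end₂ f) ⊎-dec
     (end₂ e Fin.≟ end₁ f ⊎-dec end₂ e Fin.≟ end₂ f))

  IsProperColouring : (Fin m → Fin 3) → Set
  IsProperColouring c = ∀ e f → Adjacent G e f → c e ≢ c f

  isProperColouring? : ∀ c → Dec (IsProperColouring c)
  isProperColouring? c = all? λ e → all? λ f → adjacent? e f →-dec ¬? (c e Fin.≟ c f)

  colourable? : Dec (ThreeEdgeColourable G)
  colourable? = map′ (λ (i , proper) → finToFun i , proper) from-colouring (any? (isProperColouring? ∘ finToFun))
    where
    from-colouring : ThreeEdgeColourable G → ∃ λ i → IsProperColouring (finToFun i)
    from-colouring (c , proper) = funToFin c , λ e f adj eq →
      proper e f adj (≡.trans (≡.sym (finToFun-funToFin c e)) (≡.trans eq (finToFun-funToFin c f)))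

-- Points on the boundary of the unit square

module UnitSquare (R : RealField) where
  open RealField R renaming (refl to ≈-refl; sym to ≈-sym; trans to ≈-trans)
  open IsTotalOrder ≤-isTotalOrder using (total; antisym)
    renaming (trans to ≤-trans; reflexive to ≤-reflexive;
              ≲-respˡ-≈ to ≤-respˡ-≈; ≲-respʳ-≈ to ≤-respʳ-≈)
  open import Algebra.Properties.Ring ring using (-‿involutive; -0#≈0#; -1*x≈-x; -‿distribˡ-*; -‿distribʳ-*)
  open import Algebra.Properties.Group +-group using (inverseˡ-unique; inverseʳ-unique)
  open import Algebra.Properties.AbelianGroup +-abelianGroup using (⁻¹-∙-comm)
  open import Tactic.RingSolver.NonReflective (fromCommutativeRing commRing (λ _ → nothing))
    using (solve; _⊜_; _⊕_)

  +-cancel : ∀ a b → a + (- a + b) ≈ b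
  +-cancel a b = ≈-trans (≈-sym (+-assoc a (- a) b)) (≈-trans (+-congʳ (-‿inverseʳ a)) (+-identityˡ b))

  +-cancelʳ : ∀ a b → a + b + - b ≈ a
  +-cancelʳ a b = ≈-trans (+-assoc a b (- b)) (≈-trans (+-congˡ (-‿inverseʳ b)) (+-identityʳ a))

  neg-antitone : ∀ {x y} → x ≤ y → (- y) ≤ (- x)
  neg-antitone {x} {y} x≤y =
    ≤-respʳ-≈ (≈-trans (+-congˡ (+-comm (- x) (- y))) (+-cancel y (- x)))
      (≤-respˡ-≈ (+-cancel x (- y)) (+-mono-≤ (- x + - y) x≤y))

  1≉0 : ¬ 1# ≈ 0#
  1≉0 = nontrivial ∘ ≈-sym

  0≤1 : 0# ≤ 1#
  0≤1 with total 0# 1#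
  ... | inj₁ 0≤1 = 0≤1
  ... | inj₂ 1≤0 = contradiction (antisym 1≤0 0≤1·1) 1≉0
    where
    0≤-1 : 0# ≤ (- 1#)
    0≤-1 = ≤-respˡ-≈ -0#≈0# (neg-antitone 1≤0)
    0≤1·1 : 0# ≤ 1#
    0≤1·1 = ≤-respʳ-≈ (≈-trans (-1*x≈-x (- 1#)) (-‿involutive 1#))
            (*-nonneg 0≤-1 0≤-1)

  -1≤0 : (- 1#) ≤ 0#
  -1≤0 = ≤-respʳ-≈ -0#≈0# (neg-antitone 0≤1)

  -1≤1 : (- 1#) ≤ 1#
  -1≤1 = ≤-trans -1≤0 0≤1

  neg*neg : ∀ x y → - x * - y ≈ x * y
  neg*neg x y = ≈-trans (≈-sym (-‿distribˡ-* x (- y)))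
                  (≈-trans (-‿cong (≈-sym (-‿distribʳ-* x y))) (-‿involutive (x * y)))

  neg-balance : ∀ {a b c} → a + b + c ≈ 0# → - a + - b + - c ≈ 0#
  neg-balance {a} {b} {c} e = ≈-trans (+-congʳ (⁻¹-∙-comm a b))
    (≈-trans (⁻¹-∙-comm (a + b) c) (≈-trans (-‿cong e) -0#≈0#))

  third-of-balance : ∀ {a b c} → a + b + c ≈ 0# → c ≈ - (a + b)
  third-of-balance {a} {b} {c} e = inverseˡ-unique c (a + b) (≈-trans (+-comm c (a + b)) e)

  Unit : Carrier → Set
  Unit x = x ≈ 1# ⊎ x ≈ - 1#

  Bounded : Carrier → Set
  Bounded x = (- 1#) ≤ x × x ≤ 1#

  Positive Negative : Carrier → Set
  Positive x = 0# ≤ x × ¬ x ≈ 0#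
  Negative x = x ≤ 0# × ¬ x ≈ 0#

  Concordant UnitOrConcordant : Carrier → Carrier → Set
  Concordant x y = Positive (x * y)
  UnitOrConcordant x y = Unit x ⊎ Concordant x y

  unit-resp : ∀ {x y} → x ≈ y → Unit x → Unit y
  unit-resp x≈y = Sum.map (≈-trans (≈-sym x≈y)) (≈-trans (≈-sym x≈y))

  unit-neg : ∀ {x} → Unit x → Unit (- x)
  unit-neg (inj₁ x≈1)  = inj₂ (-‿cong x≈1)
  unit-neg (inj₂ x≈-1) = inj₁ (≈-trans (-‿cong x≈-1) (-‿involutive 1#))

  unit-neg⁻ : ∀ {x} → Unit (- x) → Unit x
  unit-neg⁻ = unit-resp (-‿involutive _) ∘ unit-neg

  unit≉0 : ∀ {x} → Unit x → ¬ x ≈ 0#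
  unit≉0 (inj₁ x≈1)  x≈0 = 1≉0 (≈-trans (≈-sym x≈1) x≈0)
  unit≉0 (inj₂ x≈-1) x≈0 = 1≉0 (≈-trans (≈-sym (-‿involutive 1#))
    (≈-trans (-‿cong (≈-trans (≈-sym x≈-1) x≈0)) -0#≈0#))

  unit-bounded : ∀ {x} → Unit x → Bounded x
  unit-bounded (inj₁ x≈1)  = ≤-respʳ-≈ (≈-sym x≈1) -1≤1 , ≤-reflexive x≈1
  unit-bounded (inj₂ x≈-1) = ≤-reflexive (≈-sym x≈-1) , ≤-respˡ-≈ (≈-sym x≈-1) -1≤1

  bounded-resp : ∀ {x y} → x ≈ y → Bounded x → Bounded y
  bounded-resp x≈y (-1≤x , x≤1) = ≤-respʳ-≈ x≈y -1≤x , ≤-respˡ-≈ x≈y x≤1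

  bounded-neg : ∀ {x} → Bounded x → Bounded (- x)
  bounded-neg (-1≤x , x≤1) = neg-antitone x≤1 , ≤-respʳ-≈ (-‿involutive 1#) (neg-antitone -1≤x)

  positive-resp : ∀ {x y} → x ≈ y → Positive x → Positive y
  positive-resp x≈y (0≤x , x≉0) = ≤-respʳ-≈ x≈y 0≤x , x≉0 ∘ ≈-trans x≈y

  concordant-resp : ∀ {x x′ y y′} → x ≈ x′ → y ≈ y′ → Concordant x y → Concordant x′ y′
  concordant-resp x≈x′ y≈y′ = positive-resp (*-cong x≈x′ y≈y′)

  concordant-neg : ∀ {x y} → Concordant x y → Concordant (- x) (- y)
  concordant-neg = positive-resp (≈-sym (neg*neg _ _))

  concordant-neg⁻ : ∀ {x y} → Concordant (- x) (- y) → Concordant x y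
  concordant-neg⁻ = positive-resp (neg*neg _ _)

  ¬concordant-0 : ∀ {x y} → x ≈ 0# → ¬ Concordant x y
  ¬concordant-0 {y = y} x≈0 (_ , xy≉0) = xy≉0 (≈-trans (*-congʳ x≈0) (zeroˡ y))

  uoc-resp : ∀ {x x′ y y′} → x ≈ x′ → y ≈ y′ → UnitOrConcordant x y → UnitOrConcordant x′ y′
  uoc-resp x≈x′ y≈y′ = Sum.map (unit-resp x≈x′) (concordant-resp x≈x′ y≈y′)

  uoc-neg : ∀ {x y} → UnitOrConcordant x y → UnitOrConcordant (- x) (- y)
  uoc-neg = Sum.map unit-neg concordant-neg

  uoc-neg⁻ : ∀ {x y} → UnitOrConcordant (- x) (- y) → UnitOrConcordant x y
  uoc-neg⁻ = uoc-resp (-‿involutive _) (-‿involutive _) ∘ uoc-neg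

  ¬1+1≤1 : ¬ (1# + 1#) ≤ 1#
  ¬1+1≤1 1+1≤1 = 1≉0 (antisym 1≤0 0≤1)
    where
    1≤0 : 1# ≤ 0#
    1≤0 = ≤-respʳ-≈ (-‿inverseʳ 1#) (≤-respˡ-≈ (+-cancelʳ 1# 1#) (+-mono-≤ (- 1#) 1+1≤1))

  ¬ones-balanced : ∀ {a b c} → a ≈ 1# → b ≈ 1# → Bounded c → ¬ a + b + c ≈ 0#
  ¬ones-balanced {c = c} a≈1 b≈1 (-1≤c , _) e = ¬1+1≤1
    (≤-respʳ-≈ (-‿involutive 1#)
      (≤-respˡ-≈ (-‿involutive (1# + 1#)) (neg-antitone (≤-respʳ-≈ c≈-2 -1≤c))))
    where
    c≈-2 : c ≈ - (1# + 1#)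
    c≈-2 = ≈-trans (third-of-balance e) (-‿cong (+-cong a≈1 b≈1))

  two-units-force-zero : ∀ {a b c} → Unit a → Unit b → Bounded c → a + b + c ≈ 0# → c ≈ 0#
  two-units-force-zero (inj₁ a≈1) (inj₁ b≈1) bc e = contradiction e (¬ones-balanced a≈1 b≈1 bc)
  two-units-force-zero (inj₁ a≈1) (inj₂ b≈-1) _ e = ≈-trans (third-of-balance e)
    (≈-trans (-‿cong (≈-trans (+-cong a≈1 b≈-1) (-‿inverseʳ 1#))) -0#≈0#)
  two-units-force-zero (inj₂ a≈-1) (inj₁ b≈1) _ e = ≈-trans (third-of-balance e)
    (≈-trans (-‿cong (≈-trans (+-cong a≈-1 b≈1) (-‿inverseˡ 1#))) -0#≈0#)
  two-units-force-zero (inj₂ a≈-1) (inj₂ b≈-1) bc e = contradiction (neg-balance e)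
    (¬ones-balanced (unit-neg′ a≈-1) (unit-neg′ b≈-1) (bounded-neg bc))
    where
    unit-neg′ : ∀ {x} → x ≈ - 1# → - x ≈ 1#
    unit-neg′ x≈-1 = ≈-trans (-‿cong x≈-1) (-‿involutive 1#)

  negative-summand : ∀ {x y} → Bounded y → ¬ Unit y → x + y + 1# ≈ 0# → Negative x
  negative-summand {x} {y} (-1≤y , _) ¬unit e = x≤0 , x≉0
    where
    x≈ : x ≈ - (y + 1#)
    x≈ = inverseˡ-unique x (y + 1#) (≈-trans (≈-sym (+-assoc x y 1#)) e)
    x≤0 : x ≤ 0#
    x≤0 = ≤-respˡ-≈ (≈-sym x≈)
      (≤-respʳ-≈ -0#≈0# (neg-antitone (≤-respˡ-≈ (-‿inverseˡ 1#) (+-mono-≤ 1# -1≤y))))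
    x≉0 : ¬ x ≈ 0#
    x≉0 x≈0 = ¬unit (inj₂ (inverseˡ-unique y 1# (≈-trans (≈-sym (+-identityˡ (y + 1#)))
      (≈-trans (+-congʳ (≈-sym x≈0)) (≈-trans (≈-sym (+-assoc x y 1#)) e)))))

  negative⇒¬concordant-one : ∀ {x y} → Negative x → y ≈ 1# → ¬ Concordant x y
  negative⇒¬concordant-one (x≤0 , x≉0) y≈1 (0≤xy , _) =
    x≉0 (antisym x≤0 (≤-respʳ-≈ (≈-trans (*-congˡ y≈1) (*-identityʳ _)) 0≤xy))

  negative⇒concordant-minus-one : ∀ {x y} → Negative x → y ≈ - 1# → Concordant x y
  negative⇒concordant-minus-one {x} (x≤0 , x≉0) y≈-1 = positive-resp (≈-sym xy≈-x)
    (≤-respˡ-≈ -0#≈0# (neg-antitone x≤0) ,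
     λ -x≈0 → x≉0 (≈-trans (≈-sym (-‿involutive x)) (≈-trans (-‿cong -x≈0) -0#≈0#)))
    where
    xy≈-x : x * _ ≈ - x
    xy≈-x = ≈-trans (*-congˡ y≈-1) (≈-trans (*-comm x (- 1#)) (-1*x≈-x x))

  ExactlyOneConcordant : Carrier → Carrier → Carrier → Carrier → Set
  ExactlyOneConcordant x₁ y₁ x₂ y₂ =
    (¬ Concordant x₁ y₁ × Concordant x₂ y₂) ⊎ (Concordant x₁ y₁ × ¬ Concordant x₂ y₂)

  -- The other two x-coordinates are negative, so the sign of y₁ = - y₂ decides which product is positive.
  opposite-concordance-at-one : ∀ {x₁ y₁ x₂ y₂ x₃} → x₃ ≈ 1# →
    Bounded x₁ → Bounded x₂ → ¬ Unit x₁ → ¬ Unit x₂ → x₁ + x₂ + x₃ ≈ 0# →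
    Unit y₁ → y₁ + y₂ ≈ 0# → ExactlyOneConcordant x₁ y₁ x₂ y₂
  opposite-concordance-at-one {x₁} {y₁} {x₂} {y₂} x₃≈1 b₁ b₂ ¬u₁ ¬u₂ ex uy₁ ey = by-sign uy₁
    where
    x₁<0 : Negative x₁
    x₁<0 = negative-summand b₂ ¬u₂ (≈-trans (+-congˡ (≈-sym x₃≈1)) ex)
    x₂<0 : Negative x₂
    x₂<0 = negative-summand b₁ ¬u₁ (≈-trans (+-cong (+-comm x₂ x₁) (≈-sym x₃≈1)) ex)
    y₂≈-y₁ : y₂ ≈ - y₁
    y₂≈-y₁ = inverseʳ-unique y₁ y₂ ey
    by-sign : Unit y₁ → ExactlyOneConcordant x₁ y₁ x₂ y₂
    by-sign (inj₁ y₁≈1)  = inj₁ (negative⇒¬concordant-one x₁<0 y₁≈1 ,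
      negative⇒concordant-minus-one x₂<0 (≈-trans y₂≈-y₁ (-‿cong y₁≈1)))
    by-sign (inj₂ y₁≈-1) = inj₂ (negative⇒concordant-minus-one x₁<0 y₁≈-1 ,
      negative⇒¬concordant-one x₂<0 (≈-trans y₂≈-y₁ (≈-trans (-‿cong y₁≈-1) (-‿involutive 1#))))

  opposite-concordance : ∀ {x₁ y₁ x₂ y₂ x₃} → Unit x₃ →
    Bounded x₁ → Bounded x₂ → ¬ Unit x₁ → ¬ Unit x₂ → x₁ + x₂ + x₃ ≈ 0# →
    Unit y₁ → y₁ + y₂ ≈ 0# → ExactlyOneConcordant x₁ y₁ x₂ y₂
  opposite-concordance (inj₁ x₃≈1) = opposite-concordance-at-one x₃≈1
  opposite-concordance {y₁ = y₁} {y₂ = y₂} (inj₂ x₃≈-1) b₁ b₂ ¬u₁ ¬u₂ ex uy₁ ey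
    with opposite-concordance-at-one (≈-trans (-‿cong x₃≈-1) (-‿involutive 1#))
           (bounded-neg b₁) (bounded-neg b₂) (¬u₁ ∘ unit-neg⁻) (¬u₂ ∘ unit-neg⁻) (neg-balance ex)
           (unit-neg uy₁) (≈-trans (⁻¹-∙-comm y₁ y₂) (≈-trans (-‿cong ey) -0#≈0#))
  ... | inj₁ (¬c₁ , c₂) = inj₁ (¬c₁ ∘ concordant-neg , concordant-neg⁻ c₂)
  ... | inj₂ (c₁ , ¬c₂) = inj₂ (concordant-neg⁻ c₁ , ¬c₂ ∘ concordant-neg)

  bounded-x : ∀ {x y} → SupNormOne R (x , y) → Bounded x
  bounded-x ((-1≤x , x≤1 , _) , _) = -1≤x , x≤1

  bounded-y : ∀ {x y} → SupNormOne R (x , y) → Bounded y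
  bounded-y ((_ , _ , -1≤y , y≤1) , _) = -1≤y , y≤1

  supNormOne-transpose : ∀ {x y} → SupNormOne R (x , y) → SupNormOne R (y , x)
  supNormOne-transpose ((-1≤x , x≤1 , -1≤y , y≤1) , unit) = (-1≤y , y≤1 , -1≤x , x≤1) , Sum.swap unit

  supNormOne-resp : ∀ {x x′ y y′} → x ≈ x′ → y ≈ y′ →
                    SupNormOne R (x , y) → SupNormOne R (x′ , y′)
  supNormOne-resp x≈x′ y≈y′ n@(_ , unit) =
    (bounded-resp x≈x′ (bounded-x n) .proj₁ , bounded-resp x≈x′ (bounded-x n) .proj₂ ,
     bounded-resp y≈y′ (bounded-y n) .proj₁ , bounded-resp y≈y′ (bounded-y n) .proj₂) ,
    Sum.map (unit-resp x≈x′) (unit-resp y≈y′) unit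

  supNormOne-neg : ∀ {x y} → SupNormOne R (x , y) → SupNormOne R (- x , - y)
  supNormOne-neg n@(_ , unit) =
    (bounded-neg (bounded-x n) .proj₁ , bounded-neg (bounded-x n) .proj₂ ,
     bounded-neg (bounded-y n) .proj₁ , bounded-neg (bounded-y n) .proj₂) ,
    Sum.map unit-neg unit-neg unit

  other-unit : ∀ {x y} → SupNormOne R (x , y) → ¬ Unit x → Unit y
  other-unit (_ , inj₁ ux) ¬ux = contradiction ux ¬ux
  other-unit (_ , inj₂ uy) _   = uy

  uoc⇒concordant : ∀ {x y} → UnitOrConcordant x y → ¬ Unit x → Concordant x y
  uoc⇒concordant (inj₁ ux) ¬ux = contradiction ux ¬ux
  uoc⇒concordant (inj₂ c)  _   = c

  record Balanced (x₁ y₁ x₂ y₂ x₃ y₃ : Carrier) : Set where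
    field
      norm₁ : SupNormOne R (x₁ , y₁)
      norm₂ : SupNormOne R (x₂ , y₂)
      norm₃ : SupNormOne R (x₃ , y₃)
      sum-x : x₁ + x₂ + x₃ ≈ 0#
      sum-y : y₁ + y₂ + y₃ ≈ 0#

  module _ {x₁ y₁ x₂ y₂ x₃ y₃ : Carrier} (b : Balanced x₁ y₁ x₂ y₂ x₃ y₃) where
    open Balanced b

    swap₁₂ : Balanced x₂ y₂ x₁ y₁ x₃ y₃
    swap₁₂ = record { norm₁ = norm₂ ; norm₂ = norm₁ ; norm₃ = norm₃
                    ; sum-x = ≈-trans (+-congʳ (+-comm x₂ x₁)) sum-x
                    ; sum-y = ≈-trans (+-congʳ (+-comm y₂ y₁)) sum-y }

    swap₂₃ : Balanced x₁ y₁ x₃ y₃ x₂ y₂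
    swap₂₃ = record { norm₁ = norm₁ ; norm₂ = norm₃ ; norm₃ = norm₂
                    ; sum-x = ≈-trans (swap-last x₁ x₃ x₂) sum-x
                    ; sum-y = ≈-trans (swap-last y₁ y₃ y₂) sum-y }
      where
      swap-last : ∀ a b c → a + b + c ≈ a + c + b
      swap-last = solve 3 (λ a b c → ((a ⊕ b) ⊕ c) ⊜ ((a ⊕ c) ⊕ b)) ≈-refl

    transpose : Balanced y₁ x₁ y₂ x₂ y₃ x₃
    transpose = record { norm₁ = supNormOne-transpose norm₁ ; norm₂ = supNormOne-transpose norm₂
                       ; norm₃ = supNormOne-transpose norm₃ ; sum-x = sum-y ; sum-y = sum-x }

    two-x-units⇒¬uoc₃ : Unit x₁ → Unit x₂ → ¬ UnitOrConcordant x₃ y₃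
    two-x-units⇒¬uoc₃ u₁ u₂ = Sum.[ (λ u₃ → unit≉0 u₃ x₃≈0) , ¬concordant-0 x₃≈0 ]
      where
      x₃≈0 : x₃ ≈ 0#
      x₃≈0 = two-units-force-zero u₁ u₂ (bounded-x norm₃) sum-x

    exactly-one-concordant : ¬ Unit x₁ → ¬ Unit x₂ → ExactlyOneConcordant x₁ y₁ x₂ y₂
    exactly-one-concordant ¬u₁ ¬u₂ =
      opposite-concordance ux₃ (bounded-x norm₁) (bounded-x norm₂) ¬u₁ ¬u₂ sum-x uy₁ y₁+y₂≈0
      where
      uy₁ : Unit y₁
      uy₁ = other-unit norm₁ ¬u₁
      y₃≈0 : y₃ ≈ 0#
      y₃≈0 = two-units-force-zero uy₁ (other-unit norm₂ ¬u₂) (bounded-y norm₃) sum-y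
      ux₃ : Unit x₃
      ux₃ = other-unit (supNormOne-transpose norm₃) (λ u → unit≉0 u y₃≈0)
      y₁+y₂≈0 : y₁ + y₂ ≈ 0#
      y₁+y₂≈0 = ≈-trans (≈-sym (+-identityʳ _)) (≈-trans (+-congˡ (≈-sym y₃≈0)) sum-y)

    ¬two-¬uoc : ¬ UnitOrConcordant x₁ y₁ → ¬ UnitOrConcordant x₂ y₂ → ⊥
    ¬two-¬uoc f₁ f₂ with exactly-one-concordant (f₁ ∘ inj₁) (f₂ ∘ inj₁)
    ... | inj₁ (_ , c₂) = f₂ (inj₂ c₂)
    ... | inj₂ (c₁ , _) = f₁ (inj₂ c₁)

    ¬two-concordant : ¬ Unit x₁ → ¬ Unit x₂ → UnitOrConcordant x₁ y₁ → UnitOrConcordant x₂ y₂ → ⊥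
    ¬two-concordant ¬u₁ ¬u₂ p₁ p₂ with exactly-one-concordant ¬u₁ ¬u₂
    ... | inj₁ (¬c₁ , _) = ¬c₁ (uoc⇒concordant p₁ ¬u₁)
    ... | inj₂ (_ , ¬c₂) = ¬c₂ (uoc⇒concordant p₂ ¬u₂)

  ¬three-uoc : ∀ {x₁ y₁ x₂ y₂ x₃ y₃} → Balanced x₁ y₁ x₂ y₂ x₃ y₃ →
    UnitOrConcordant x₁ y₁ → UnitOrConcordant x₂ y₂ → UnitOrConcordant x₃ y₃ → ⊥
  ¬three-uoc {x₁} {_} {x₂} {_} {x₃} b p₁ p₂ p₃ =
    ¬¬-excluded-middle λ u₁? → ¬¬-excluded-middle λ u₂? → ¬¬-excluded-middle λ u₃? →
      by-cases u₁? u₂? u₃?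
    where
    by-cases : Dec (Unit x₁) → Dec (Unit x₂) → Dec (Unit x₃) → ⊥
    by-cases (yes u₁) (yes u₂) _        = two-x-units⇒¬uoc₃ b u₁ u₂ p₃
    by-cases (yes u₁) (no ¬u₂) (yes u₃) = two-x-units⇒¬uoc₃ (swap₂₃ b) u₁ u₃ p₂
    by-cases (yes u₁) (no ¬u₂) (no ¬u₃) = ¬two-concordant (swap₂₃ (swap₁₂ b)) ¬u₂ ¬u₃ p₂ p₃
    by-cases (no ¬u₁) (yes u₂) (yes u₃) = two-x-units⇒¬uoc₃ (swap₂₃ (swap₁₂ b)) u₂ u₃ p₁
    by-cases (no ¬u₁) (yes u₂) (no ¬u₃) = ¬two-concordant (swap₂₃ b) ¬u₁ ¬u₃ p₁ p₃
    by-cases (no ¬u₁) (no ¬u₂) _        = ¬two-concordant b ¬u₁ ¬u₂ p₁ p₂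

  -- On the boundary of the square colour 2 is {xy > 0} together with the four corners; colours 0 and 1
  -- are the remaining points of the vertical and of the horizontal sides.
  data HasColour (x y : Carrier) : Fin 3 → Set where
    colour₀ : UnitOrConcordant x y → ¬ UnitOrConcordant y x → HasColour x y 0F
    colour₁ : ¬ UnitOrConcordant x y → UnitOrConcordant y x → HasColour x y 1F
    colour₂ : UnitOrConcordant x y → UnitOrConcordant y x → HasColour x y 2F

  colour-resp : ∀ {x x′ y y′ k} → x ≈ x′ → y ≈ y′ → HasColour x y k → HasColour x′ y′ k
  colour-resp x≈ y≈ (colour₀ p ¬q) =
    colour₀ (uoc-resp x≈ y≈ p) (¬q ∘ uoc-resp (≈-sym y≈) (≈-sym x≈))
  colour-resp x≈ y≈ (colour₁ ¬p q) =
    colour₁ (¬p ∘ uoc-resp (≈-sym x≈) (≈-sym y≈)) (uoc-resp y≈ x≈ q)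
  colour-resp x≈ y≈ (colour₂ p q)  = colour₂ (uoc-resp x≈ y≈ p) (uoc-resp y≈ x≈ q)

  colour-neg : ∀ {x y k} → HasColour x y k → HasColour (- x) (- y) k
  colour-neg (colour₀ p ¬q) = colour₀ (uoc-neg p) (¬q ∘ uoc-neg⁻)
  colour-neg (colour₁ ¬p q) = colour₁ (¬p ∘ uoc-neg⁻) (uoc-neg q)
  colour-neg (colour₂ p q)  = colour₂ (uoc-neg p) (uoc-neg q)

  some-colour : ∀ {x y} → SupNormOne R (x , y) → ¬ ¬ ∃ (HasColour x y)
  some-colour {x} {y} (_ , unit) ¬col = ¬¬-excluded-middle λ p? → ¬¬-excluded-middle λ q? → by-cases p? q?
    where
    by-cases : Dec (UnitOrConcordant x y) → Dec (UnitOrConcordant y x) → ⊥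
    by-cases (yes p) (yes q) = ¬col (_ , colour₂ p q)
    by-cases (yes p) (no ¬q) = ¬col (_ , colour₀ p ¬q)
    by-cases (no ¬p) (yes q) = ¬col (_ , colour₁ ¬p q)
    by-cases (no ¬p) (no ¬q) = Sum.[ ¬p ∘ inj₁ , ¬q ∘ inj₁ ] unit

  -- Exactly two of three balanced points satisfy UnitOrConcordant x y (¬two-¬uoc, ¬three-uoc), and
  -- likewise with the coordinates exchanged.
  ¬same-colour : ∀ {x₁ y₁ x₂ y₂ x₃ y₃ k} → Balanced x₁ y₁ x₂ y₂ x₃ y₃ →
    HasColour x₁ y₁ k → HasColour x₂ y₂ k → ⊥
  ¬same-colour b (colour₀ _ ¬q₁) (colour₀ _ ¬q₂) = ¬two-¬uoc (transpose b) ¬q₁ ¬q₂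
  ¬same-colour b (colour₁ ¬p₁ _) (colour₁ ¬p₂ _) = ¬two-¬uoc b ¬p₁ ¬p₂
  ¬same-colour b (colour₂ p₁ q₁) (colour₂ p₂ q₂) with Balanced.norm₃ b
  ... | _ , inj₁ ux₃ = ¬three-uoc b p₁ p₂ (inj₁ ux₃)
  ... | _ , inj₂ uy₃ = ¬three-uoc (transpose b) q₁ q₂ (inj₁ uy₃)

  same-colour⇒same-index : ∀ (x y : Fin 3 → Carrier) {i j k} →
    Balanced (x 0F) (y 0F) (x 1F) (y 1F) (x 2F) (y 2F) →
    HasColour (x i) (y i) k → HasColour (x j) (y j) k → i ≡ j
  same-colour⇒same-index x y {0F} {0F} b c c′ = refl
  same-colour⇒same-index x y {1F} {1F} b c c′ = refl
  same-colour⇒same-index x y {2F} {2F} b c c′ = refl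
  same-colour⇒same-index x y {0F} {1F} b c c′ = ⊥-elim (¬same-colour b c c′)
  same-colour⇒same-index x y {1F} {0F} b c c′ = ⊥-elim (¬same-colour b c′ c)
  same-colour⇒same-index x y {0F} {2F} b c c′ = ⊥-elim (¬same-colour (swap₂₃ b) c c′)
  same-colour⇒same-index x y {2F} {0F} b c c′ = ⊥-elim (¬same-colour (swap₂₃ b) c′ c)
  same-colour⇒same-index x y {1F} {2F} b c c′ = ⊥-elim (¬same-colour (swap₂₃ (swap₁₂ b)) c c′)
  same-colour⇒same-index x y {2F} {1F} b c c′ = ⊥-elim (¬same-colour (swap₂₃ (swap₁₂ b)) c′ c)

  supNormOne : ∀ {x y} → Bounded x → Bounded y → Unit x ⊎ Unit y → SupNormOne R (x , y)
  supNormOne (-1≤x , x≤1) (-1≤y , y≤1) unit = (-1≤x , x≤1 , -1≤y , y≤1) , unit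

  0-bounded : Bounded 0#
  0-bounded = -1≤0 , 0≤1

  sign : Bool → Carrier
  sign true  = 1#
  sign false = - 1#

  sign-unit : ∀ s → Unit (sign s)
  sign-unit true  = inj₁ ≈-refl
  sign-unit false = inj₂ ≈-refl

  sign-not : ∀ s → sign (not s) ≈ - sign s
  sign-not true  = ≈-refl
  sign-not false = ≈-sym (-‿involutive 1#)

  sign-cancel : ∀ s → sign s + sign (not s) ≈ 0#
  sign-cancel s = ≈-trans (+-congˡ (sign-not s)) (-‿inverseʳ (sign s))

-- Flow conservation at a vertex

module Conservation (R : RealField) (G : Graph) where
  open RealField R hiding (zero) renaming (refl to ≈-refl; sym to ≈-sym; trans to ≈-trans)
  open Graph G
  open FiniteSum +-commutativeMonoid using (sum; sum-support)
  open import Algebra.Properties.Group +-group using (x≈y⇒x∙y⁻¹≈ε; x∙y⁻¹≈ε⇒x≈y)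
  open import Algebra.Properties.Ring ring using (-0#≈0#)
  open import Tactic.RingSolver.NonReflective (fromCommutativeRing commRing (λ _ → nothing))
    using (solve; _⊜_; _⊕_; ⊝_)
  open import Relation.Binary.Reasoning.Setoid setoid

  sumR≡sum : ∀ {k} (f : Fin k → Carrier) → sumR R f ≡ sum f
  sumR≡sum {ℕ.zero}  f = refl
  sumR≡sum {ℕ.suc k} f = ≡.cong (f zero +_) (sumR≡sum (f ∘ suc))

  sum₃ : (f : Fin 3 → Carrier) → sum f ≈ f 0F + f 1F + f 2F
  sum₃ f = ≈-trans (+-congˡ (+-congˡ (+-identityʳ (f 2F)))) (≈-sym (+-assoc (f 0F) (f 1F) (f 2F)))

  -- This is the private pick of Defs, so IsR2Flow R G o φ unfolds to conservation in each coordinate.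
  onlyAt : Fin n → Fin n → Carrier → Carrier
  onlyAt a v x = if does (a Fin.≟ v) then x else 0#

  onlyAt-≡ : ∀ {a v} x → a ≡ v → onlyAt a v x ≈ x
  onlyAt-≡ {a} {v} x a≡v = reflexive (≡.cong (if_then x else 0#) (dec-true (a Fin.≟ v) a≡v))

  onlyAt-≢ : ∀ {a v} x → a ≢ v → onlyAt a v x ≈ 0#
  onlyAt-≢ {a} {v} x a≢v = reflexive (≡.cong (if_then x else 0#) (dec-false (a Fin.≟ v) a≢v))

  Conserved : (Fin m → Bool) → (Fin m → Carrier) → Fin n → Set
  Conserved o x v = sumR R (λ e → onlyAt (head R G o e) v (x e)) ≈ sumR R (λ e → onlyAt (tail R G o e) v (x e))

  outflow : (Fin m → Bool) → (Fin m → Carrier) → Fin n → Fin m → Carrier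
  outflow o x v e = onlyAt (tail R G o e) v (x e) - onlyAt (head R G o e) v (x e)

  module _ (o : Fin m → Bool) where

    head≢tail : ∀ e → head R G o e ≢ tail R G o e
    head≢tail e with o e
    ... | true  = loopless e ∘ ≡.sym
    ... | false = loopless e

    incident⇒tail⊎head : ∀ {v e} → Incident G v e → tail R G o e ≡ v ⊎ head R G o e ≡ v
    incident⇒tail⊎head {e = e} inc with o e | inc
    ... | true  | inj₁ p = inj₁ p
    ... | true  | inj₂ p = inj₂ p
    ... | false | inj₁ p = inj₂ p
    ... | false | inj₂ p = inj₁ p

    nonincident-tail : ∀ {v e} → ¬ Incident G v e → tail R G o e ≢ v
    nonincident-tail {e = e} ¬inc with o e
    ... | true  = ¬inc ∘ inj₁
    ... | false = ¬inc ∘ inj₂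

    nonincident-head : ∀ {v e} → ¬ Incident G v e → head R G o e ≢ v
    nonincident-head {e = e} ¬inc with o e
    ... | true  = ¬inc ∘ inj₂
    ... | false = ¬inc ∘ inj₁

    outflow-outgoing : ∀ x {v e} → tail R G o e ≡ v → outflow o x v e ≈ x e
    outflow-outgoing x {v} {e} t≡v = begin
      onlyAt (tail R G o e) v (x e) - onlyAt (head R G o e) v (x e)
        ≈⟨ +-cong (onlyAt-≡ (x e) t≡v) (-‿cong (onlyAt-≢ (x e) h≢v)) ⟩
      x e - 0#  ≈⟨ +-congˡ -0#≈0# ⟩
      x e + 0#  ≈⟨ +-identityʳ (x e) ⟩
      x e       ∎
      where
      h≢v : head R G o e ≢ v
      h≢v h≡v = head≢tail e (≡.trans h≡v (≡.sym t≡v))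

    outflow-incoming : ∀ x {v e} → head R G o e ≡ v → outflow o x v e ≈ - x e
    outflow-incoming x {v} {e} h≡v = begin
      onlyAt (tail R G o e) v (x e) - onlyAt (head R G o e) v (x e)
        ≈⟨ +-cong (onlyAt-≢ (x e) t≢v) (-‿cong (onlyAt-≡ (x e) h≡v)) ⟩
      0# - x e  ≈⟨ +-identityˡ (- x e) ⟩
      - x e     ∎
      where
      t≢v : tail R G o e ≢ v
      t≢v t≡v = head≢tail e (≡.trans h≡v (≡.sym t≡v))

    conserved⇔outflow-balanced : ∀ x {v} (E : Enumeration (Incident G v) 3) →
      let t = Enumeration.elem E in
      Conserved o x v ⇔ (outflow o x v (t 0F) + outflow o x v (t 1F) + outflow o x v (t 2F) ≈ 0#)
    conserved⇔outflow-balanced x {v} E = mk⇔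
      (λ in≈out → ≈-trans regroup
        (x≈y⇒x∙y⁻¹≈ε (≈-trans (≈-sym out≈) (≈-trans (≈-sym in≈out) in≈))))
      (λ balanced → ≈-trans in≈
        (≈-trans (≈-sym (x∙y⁻¹≈ε⇒x≈y _ _ (≈-trans (≈-sym regroup) balanced))) (≈-sym out≈)))
      where
      open Enumeration E
      over-edges : (end : Fin m → Fin n) → (∀ {e} → ¬ Incident G v e → end e ≢ v) →
                   sumR R (λ e → onlyAt (end e) v (x e)) ≈
                   onlyAt (end (elem 0F)) v (x (elem 0F)) + onlyAt (end (elem 1F)) v (x (elem 1F))
                     + onlyAt (end (elem 2F)) v (x (elem 2F))
      over-edges end avoids = ≈-trans (reflexive (sumR≡sum f)) (≈-trans
        (sum-support elem elem-injective f λ e ∉ → onlyAt-≢ (x e) (avoids λ inc →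
          let j , eq = elem-complete inc in ∉ j eq))
        (sum₃ (f ∘ elem)))
        where
        f : Fin m → Carrier
        f e = onlyAt (end e) v (x e)
      in≈  = over-edges (head R G o) nonincident-head
      out≈ = over-edges (tail R G o) nonincident-tail
      regroup : ∀ {o₀ o₁ o₂ i₀ i₁ i₂} →
                (o₀ - i₀) + (o₁ - i₁) + (o₂ - i₂) ≈ (o₀ + o₁ + o₂) - (i₀ + i₁ + i₂)
      regroup {o₀} {o₁} {o₂} {i₀} {i₁} {i₂} = solve 6 (λ o₀ o₁ o₂ i₀ i₁ i₂ →
          (((o₀ ⊕ (⊝ i₀)) ⊕ (o₁ ⊕ (⊝ i₁))) ⊕ (o₂ ⊕ (⊝ i₂)))
        ⊜ (((o₀ ⊕ o₁) ⊕ o₂) ⊕ (⊝ ((i₀ ⊕ i₁) ⊕ i₂))))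
        ≈-refl o₀ o₁ o₂ i₀ i₁ i₂

  potential-conserved : (h : Fin n → Fin m → Carrier) → (∀ e → h (end₂ e) e ≈ - h (end₁ e) e) →
    ∀ {v} (E : Enumeration (Incident G v) 3) → let t = Enumeration.elem E in
    h v (t 0F) + h v (t 1F) + h v (t 2F) ≈ 0# → Conserved (λ _ → true) (λ e → h (end₁ e) e) v
  potential-conserved h antisymmetric {v} E balanced =
    Equivalence.from (conserved⇔outflow-balanced (λ _ → true) x E)
      (≈-trans (+-cong (+-cong (outflow≈h 0F) (outflow≈h 1F)) (outflow≈h 2F)) balanced)
    where
    open Enumeration E
    x : Fin m → Carrier
    x e = h (end₁ e) e
    outflow≈h : ∀ j → outflow (λ _ → true) x v (elem j) ≈ h v (elem j)
    outflow≈h j with elem-sound j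
    ... | inj₁ end₁≡v = ≈-trans (outflow-outgoing (λ _ → true) x end₁≡v)
                          (reflexive (≡.cong (λ u → h u (elem j)) end₁≡v))
    ... | inj₂ end₂≡v = ≈-trans (outflow-incoming (λ _ → true) x end₂≡v)
                          (≈-trans (≈-sym (antisymmetric (elem j)))
                                   (reflexive (≡.cong (λ u → h u (elem j)) end₂≡v)))

-- From flows to colourings

module FlowToColouring (R : RealField) (G : Graph) (cubic : Cubic G) where
  open RealField R hiding (zero) renaming (refl to ≈-refl; sym to ≈-sym; trans to ≈-trans)
  open Graph G
  open UnitSquare R
  open Conservation R G

  module _ (o : Fin m → Bool) (φ : Fin m → Carrier × Carrier)
           (flow : IsR2Flow R G o φ) (norm : ∀ e → SupNormOne R (φ e)) where

    φ₁ φ₂ : Fin m → Carrier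
    φ₁ = proj₁ ∘ φ
    φ₂ = proj₂ ∘ φ

    outflow-colour : ∀ {v e k} → Incident G v e → HasColour (φ₁ e) (φ₂ e) k →
                     HasColour (outflow o φ₁ v e) (outflow o φ₂ v e) k
    outflow-colour inc c with incident⇒tail⊎head o inc
    ... | inj₁ t≡v = colour-resp (≈-sym (outflow-outgoing o φ₁ t≡v)) (≈-sym (outflow-outgoing o φ₂ t≡v)) c
    ... | inj₂ h≡v = colour-resp (≈-sym (outflow-incoming o φ₁ h≡v)) (≈-sym (outflow-incoming o φ₂ h≡v))
                                 (colour-neg c)

    outflow-norm : ∀ {v e} → Incident G v e → SupNormOne R (outflow o φ₁ v e , outflow o φ₂ v e)
    outflow-norm {e = e} inc with incident⇒tail⊎head o inc
    ... | inj₁ t≡v = supNormOne-resp (≈-sym (outflow-outgoing o φ₁ t≡v)) (≈-sym (outflow-outgoing o φ₂ t≡v))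
                                     (norm e)
    ... | inj₂ h≡v = supNormOne-resp (≈-sym (outflow-incoming o φ₁ h≡v)) (≈-sym (outflow-incoming o φ₂ h≡v))
                                     (supNormOne-neg (norm e))

    module AtVertex (v : Fin n) where
      open Enumeration (edgesAt G cubic v) public

      x y : Fin 3 → Carrier
      x j = outflow o φ₁ v (elem j)
      y j = outflow o φ₂ v (elem j)

      balanced : Balanced (x 0F) (y 0F) (x 1F) (y 1F) (x 2F) (y 2F)
      balanced = record
        { norm₁ = outflow-norm (elem-sound 0F)
        ; norm₂ = outflow-norm (elem-sound 1F)
        ; norm₃ = outflow-norm (elem-sound 2F)
        ; sum-x = Equivalence.to (conserved⇔outflow-balanced o φ₁ (edgesAt G cubic v)) (proj₁ (flow v))
        ; sum-y = Equivalence.to (conserved⇔outflow-balanced o φ₂ (edgesAt G cubic v)) (proj₂ (flow v))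
        }

      same-colour⇒same-edge : ∀ {e f k} → Incident G v e → Incident G v f →
        HasColour (φ₁ e) (φ₂ e) k → HasColour (φ₁ f) (φ₂ f) k → e ≡ f
      same-colour⇒same-edge inc-e inc-f ce cf with elem-complete inc-e | elem-complete inc-f
      ... | i , refl | j , refl = ≡.cong elem
        (same-colour⇒same-index x y balanced (outflow-colour inc-e ce) (outflow-colour inc-f cf))

    proper : (colour : ∀ e → ∃ (HasColour (φ₁ e) (φ₂ e))) → IsProperColouring G (proj₁ ∘ colour)
    proper colour e f adj same = proj₁ adj (AtVertex.same-colour⇒same-edge v inc-e inc-f
      (proj₂ (colour e)) (≡.subst (HasColour (φ₁ f) (φ₂ f)) (≡.sym same) (proj₂ (colour f))))
      where
      v     = proj₁ (adjacent⇒common-vertex G adj)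
      inc-e = proj₁ (proj₂ (adjacent⇒common-vertex G adj))
      inc-f = proj₂ (proj₂ (adjacent⇒common-vertex G adj))

  flow⇒colourable : Has22ChNZF R G → ThreeEdgeColourable G
  flow⇒colourable (o , φ , flow , norm) = decidable-stable (colourable? G) λ ¬colourable →
    sequence ¬¬-applicative (λ e → some-colour (norm e)) λ colour →
      ¬colourable (proj₁ ∘ colour , proper o φ flow norm colour)
    where
    ¬¬-applicative = RawMonad.rawApplicative (¬¬-Monad {a = 0ℓ})

-- From colourings to flows

module ColouringToFlow (R : RealField) (G : Graph) (cubic : Cubic G)
  (c : Fin (Graph.m G) → Fin 3) (proper : IsProperColouring G c) where
  open RealField R hiding (zero) renaming (refl to ≈-refl; sym to ≈-sym; trans to ≈-trans)
  open Graph G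
  open UnitSquare R
  open Conservation R G
  open import Algebra.Properties.Ring ring using (-0#≈0#)

  colours-distinct-at : ∀ v → Injective _≡_ _≡_ (c ∘ Enumeration.elem (edgesAt G cubic v))
  colours-distinct-at v {i} {j} same = decidable-stable (i Fin.≟ j) λ i≢j →
    proper (elem i) (elem j) (incident⇒adjacent G (elem-sound i) (elem-sound j) (i≢j ∘ elem-injective)) same
    where open Enumeration (edgesAt G cubic v)

  module _ (v : Fin n) where
    open Enumeration (edgesAt G cubic v)

    private
      slot : Fin 3 → Fin 3
      slot k = proj₁ (injective⇒surjective (colours-distinct-at v) k)

    edgeOfColour : Fin 3 → Fin m
    edgeOfColour k = elem (slot k)

    edgeOfColour-colour : ∀ k → c (edgeOfColour k) ≡ k
    edgeOfColour-colour k = proj₂ (injective⇒surjective (colours-distinct-at v) k)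

    edgeOfColour-incident : ∀ k → Incident G v (edgeOfColour k)
    edgeOfColour-incident k = elem-sound (slot k)

    edgeOfColour-unique : ∀ {e} → Incident G v e → edgeOfColour (c e) ≡ e
    edgeOfColour-unique inc with elem-complete inc
    ... | j , refl = ≡.cong elem (colours-distinct-at v (edgeOfColour-colour (c (elem j))))

    edgesByColour : Enumeration (Incident G v) 3
    edgesByColour = record
      { elem           = edgeOfColour
      ; elem-injective = λ {k} {l} same → ≡.trans (≡.sym (edgeOfColour-colour k))
                           (≡.trans (≡.cong c same) (edgeOfColour-colour l))
      ; elem-sound     = edgeOfColour-incident
      ; elem-complete  = λ {e} inc → c e , edgeOfColour-unique inc
      }

  opposite : Fin m → Fin n → Fin n
  opposite e v = if does (end₁ e Fin.≟ v) then end₂ e else end₁ e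

  opposite-end₁ : ∀ e → opposite e (end₁ e) ≡ end₂ e
  opposite-end₁ e = ≡.cong (if_then end₂ e else end₁ e) (dec-true (end₁ e Fin.≟ end₁ e) refl)

  opposite-end₂ : ∀ e → opposite e (end₂ e) ≡ end₁ e
  opposite-end₂ e = ≡.cong (if_then end₂ e else end₁ e) (dec-false (end₁ e Fin.≟ end₂ e) (loopless e))

  module Matching (k : Fin 3) where
    open ≡.≡-Reasoning

    partner : Fin n → Fin n
    partner v = opposite (edgeOfColour v k) v

    partner-end₁ : ∀ {e} → c e ≡ k → partner (end₁ e) ≡ end₂ e
    partner-end₁ {e} refl =
      ≡.trans (≡.cong (λ f → opposite f (end₁ e)) (edgeOfColour-unique (end₁ e) (inj₁ refl))) (opposite-end₁ e)

    partner-end₂ : ∀ {e} → c e ≡ k → partner (end₂ e) ≡ end₁ e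
    partner-end₂ {e} refl =
      ≡.trans (≡.cong (λ f → opposite f (end₂ e)) (edgeOfColour-unique (end₂ e) (inj₂ refl))) (opposite-end₂ e)

    partner-involutive : ∀ v → partner (partner v) ≡ v
    partner-involutive v = [ via-end₁ , via-end₂ ]′ (edgeOfColour-incident v k)
      where
      e = edgeOfColour v k
      coloured = edgeOfColour-colour v k
      via-end₁ : end₁ e ≡ v → partner (partner v) ≡ v
      via-end₁ p = begin
        partner (partner v)       ≡⟨ ≡.cong (partner ∘ partner) (≡.sym p) ⟩
        partner (partner (end₁ e)) ≡⟨ ≡.cong partner (partner-end₁ coloured) ⟩
        partner (end₂ e)          ≡⟨ partner-end₂ coloured ⟩
        end₁ e                    ≡⟨ p ⟩
        v                         ∎
      via-end₂ : end₂ e ≡ v → partner (partner v) ≡ v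
      via-end₂ p = begin
        partner (partner v)       ≡⟨ ≡.cong (partner ∘ partner) (≡.sym p) ⟩
        partner (partner (end₂ e)) ≡⟨ ≡.cong partner (partner-end₂ coloured) ⟩
        partner (end₁ e)          ≡⟨ partner-end₁ coloured ⟩
        end₂ e                    ≡⟨ p ⟩
        v                         ∎

    partner-fixpoint-free : ∀ v → partner v ≢ v
    partner-fixpoint-free v = [ via-end₁ , via-end₂ ]′ (edgeOfColour-incident v k)
      where
      e = edgeOfColour v k
      coloured = edgeOfColour-colour v k
      via-end₁ : end₁ e ≡ v → partner v ≢ v
      via-end₁ p fixed = loopless e (≡.sym (≡.trans (≡.sym (partner-end₁ coloured))
        (≡.subst (λ u → partner u ≡ u) (≡.sym p) fixed)))
      via-end₂ : end₂ e ≡ v → partner v ≢ v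
      via-end₂ p fixed = loopless e (≡.trans (≡.sym (partner-end₂ coloured))
        (≡.subst (λ u → partner u ≡ u) (≡.sym p) fixed))

  module Sides (k : Fin 3) = Alternation (Matching.partner 0F) (Matching.partner k)
    (Matching.partner-involutive 0F) (Matching.partner-involutive k)
    (Matching.partner-fixpoint-free 0F) (Matching.partner-fixpoint-free k)

  side-flips : ∀ k e → c e ≡ 0F ⊎ c e ≡ k → Sides.side k (end₂ e) ≡ not (Sides.side k (end₁ e))
  side-flips k e (inj₁ c≡0) =
    ≡.trans (≡.cong (Sides.side k) (≡.sym (Matching.partner-end₁ 0F c≡0))) (Sides.side-σ k (end₁ e))
  side-flips k e (inj₂ c≡k) =
    ≡.trans (≡.cong (Sides.side k) (≡.sym (Matching.partner-end₁ k c≡k))) (Sides.side-τ k (end₁ e))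

  -- Coordinate i is the ±1 circulation around the cycles of colours 0 and i, signed by the side of the tail.
  weight₁ weight₂ : Fin 3 → Bool → Carrier
  weight₁ 0F s = sign s
  weight₁ 1F s = sign (not s)
  weight₁ 2F s = 0#
  weight₂ 0F s = sign s
  weight₂ 1F s = 0#
  weight₂ 2F s = sign (not s)

  side₁ side₂ : Fin n → Bool
  side₁ = Sides.side 1F
  side₂ = Sides.side 2F

  φ : Fin m → Carrier × Carrier
  φ e = weight₁ (c e) (side₁ (end₁ e)) , weight₂ (c e) (side₂ (end₁ e))

  weight₁-flip : ∀ k {s s′} → (k ≡ 0F ⊎ k ≡ 1F → s′ ≡ not s) → weight₁ k s′ ≈ - weight₁ k s
  weight₁-flip 0F {s} flips = ≈-trans (reflexive (≡.cong sign (flips (inj₁ refl)))) (sign-not s)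
  weight₁-flip 1F {s} flips = ≈-trans (reflexive (≡.cong (sign ∘ not) (flips (inj₂ refl)))) (sign-not (not s))
  weight₁-flip 2F _     = ≈-sym -0#≈0#

  weight₂-flip : ∀ k {s s′} → (k ≡ 0F ⊎ k ≡ 2F → s′ ≡ not s) → weight₂ k s′ ≈ - weight₂ k s
  weight₂-flip 0F {s} flips = ≈-trans (reflexive (≡.cong sign (flips (inj₁ refl)))) (sign-not s)
  weight₂-flip 1F _     = ≈-sym -0#≈0#
  weight₂-flip 2F {s} flips = ≈-trans (reflexive (≡.cong (sign ∘ not) (flips (inj₂ refl)))) (sign-not (not s))

  weights-norm : ∀ k s₁ s₂ → SupNormOne R (weight₁ k s₁ , weight₂ k s₂)
  weights-norm 0F s₁ s₂ =
    supNormOne (unit-bounded (sign-unit s₁)) (unit-bounded (sign-unit s₂)) (inj₁ (sign-unit s₁))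
  weights-norm 1F s₁ s₂ = supNormOne (unit-bounded (sign-unit (not s₁))) 0-bounded (inj₁ (sign-unit (not s₁)))
  weights-norm 2F s₁ s₂ = supNormOne 0-bounded (unit-bounded (sign-unit (not s₂))) (inj₂ (sign-unit (not s₂)))

  weights-balanced : ∀ (weight : Fin 3 → Bool → Carrier) →
    (∀ s → weight 0F s + weight 1F s + weight 2F s ≈ 0#) →
    (side : Fin n → Bool) → ∀ v → let t = edgeOfColour v in
    weight (c (t 0F)) (side v) + weight (c (t 1F)) (side v) + weight (c (t 2F)) (side v) ≈ 0#
  weights-balanced weight balanced side v = ≈-trans (+-cong (+-cong (at 0F) (at 1F)) (at 2F)) (balanced (side v))
    where
    at : ∀ k → weight (c (edgeOfColour v k)) (side v) ≈ weight k (side v)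
    at k = reflexive (≡.cong (λ j → weight j (side v)) (edgeOfColour-colour v k))

  conserved₁ : ∀ v → Conserved (λ _ → true) (proj₁ ∘ φ) v
  conserved₁ v = potential-conserved (λ u e → weight₁ (c e) (side₁ u))
    (λ e → weight₁-flip (c e) (side-flips 1F e)) (edgesByColour v)
    (weights-balanced weight₁ (λ s → ≈-trans (+-identityʳ _) (sign-cancel s)) side₁ v)

  conserved₂ : ∀ v → Conserved (λ _ → true) (proj₂ ∘ φ) v
  conserved₂ v = potential-conserved (λ u e → weight₂ (c e) (side₂ u))
    (λ e → weight₂-flip (c e) (side-flips 2F e)) (edgesByColour v)
    (weights-balanced weight₂ (λ s → ≈-trans (+-congʳ (+-identityʳ _)) (sign-cancel s)) side₂ v)

  flow : Has22ChNZF R G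
  flow = (λ _ → true) , φ , (λ v → conserved₁ v , conserved₂ v) , λ e → weights-norm (c e) _ _

theorem19 : (R : RealField) (G : Graph) → Cubic G →
    (Has22ChNZF R G ⇔ ThreeEdgeColourable G)
theorem19 R G cubic = mk⇔ (FlowToColouring.flow⇒colourable R G cubic)
  λ (c , proper) → ColouringToFlow.flow R G cubic c proper
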